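{- Let $A=\{a_1\le\dots\le a_n\}$ be a sorted multiset of positive integers, $p$ an integer with $1\le p\le n-k+1$, and $\varepsilon\in(0,1)$. Let $\delta=\frac{\varepsilon\cdot a_p}{3n}$, $a_i^r=\lfloor a_i/\delta\rfloor$ for $i\in[n]$, and $A_r=\{a_1^r,\dots,a_n^r\}$. Let $(S_1,\dots,S_k)$ be an optimal solution of the $k$-SSR$_R$ instance $(A_r,p)$ and $(S_1^*,\dots,S_k^*)$ an optimal solution of the $k$-SSR$_R$ instance $(A,p)$. Then \[\mathcal{R}(S_1,\dots,S_k,A)\le(1+\varepsilon)\cdot\mathcal{R}(S_1^*,\dots,S_k^*,A).\]
   Context: $k\ge2$ is a fixed integer, $[n]=\{1,\dots,n\}$. For a multiset $B=\{b_1,\dots,b_n\}$ of nonnegative integers and $S\subseteq[n]$, $\Sigma(S,B)=\sum_{i\in S}b_i$. For pairwise disjoint $S_1,\dots,S_k\subseteq[n]$, with $M=\max_i\Sigma(S_i,B)$ and $m=\min_i\Sigma(S_i,B)$, the ratio $\mathcal{R}(S_1,\dots,S_k,B)$ is $M/m$ if $m>0$ and $+\infty$ if $m=0$. The $k$-SSR$_R$ problem on $(B,p)$: find pairwise disjoint $S_1,\dots,S_k\subseteq[n]$ with $\max(S_1)=p$ and $\max(S_i)>p$ for $1<i\le k$ minimizing $\mathcal{R}(S_1,\dots,S_k,B)$. -}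

module Defs where

open import Data.Nat as ℕ using (ℕ; zero; suc; _⊔_; _⊓_)
open import Data.Integer as ℤ using (ℤ; +_; +[1+_])
open import Data.Rational as ℚ using (ℚ; ↥_; ↧ₙ_; 0ℚ; floor)
open import Data.Fin as Fin using (Fin; toℕ)
open import Data.Fin.Subset using (Subset; _∈_; _∉_)
open import Data.Vec using (Vec; []; _∷_; lookup; map)
open import Data.Bool using (Bool; true; false)
open import Data.Product using (Σ; _×_; ∃)
open import Data.Unit using (⊤)
open import Data.Empty using (⊥)
open import Relation.Binary.PropositionalEquality using (_≡_; _≢_)

-- Σ(S,B) = sum of b_i over i ∈ S  (index Fin i stands for i+1 ∈ [n])
ΣS : ∀ {n} → Subset n → Vec ℕ n → ℕ
ΣS [] [] = 0
ΣS (true ∷ S) (b ∷ B) = b ℕ.+ ΣS S B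
ΣS (false ∷ S) (b ∷ B) = ΣS S B

-- max / min of finitely many naturals (min used only for k ≥ 1)
maxF : ∀ k → (Fin k → ℕ) → ℕ
maxF zero f = 0
maxF (suc k) f = f Fin.zero ⊔ maxF k (λ i → f (Fin.suc i))

minF : ∀ k → (Fin k → ℕ) → ℕ
minF zero f = 0
minF (suc zero) f = f Fin.zero
minF (suc (suc k)) f = f Fin.zero ⊓ minF (suc k) (λ i → f (Fin.suc i))

data ℚ∞ : Set where
  fin : ℚ → ℚ∞
  ∞   : ℚ∞

_≤∞_ : ℚ∞ → ℚ∞ → Set
fin x ≤∞ fin y = x ℚ.≤ y
fin x ≤∞ ∞ = ⊤
∞ ≤∞ fin y = ⊥
∞ ≤∞ ∞ = ⊤

scale : ℚ → ℚ∞ → ℚ∞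
scale c (fin x) = fin (c ℚ.* x)
scale c ∞ = ∞

ratio : ∀ k {n} → (Fin k → Subset n) → Vec ℕ n → ℚ∞
ratio k S B with minF k (λ i → ΣS (S i) B)
... | zero  = ∞
... | suc m = fin ((+ maxF k (λ i → ΣS (S i) B)) ℚ./ suc m)

-- "max(S) = p" (1-based p): p ∈ S and every element of S is ≤ p
MaxIs : ∀ {n} → Subset n → ℕ → Set
MaxIs S p = (∃ λ j → j ∈ S × suc (toℕ j) ≡ p) × (∀ j → j ∈ S → suc (toℕ j) ℕ.≤ p)

MaxAbove : ∀ {n} → Subset n → ℕ → Set
MaxAbove S p = ∃ λ j → j ∈ S × p ℕ.< suc (toℕ j)

-- feasible solutions of k-SSR_R on (B,p); S_1 is index Fin.zero
Feasible : ∀ k {n} → Vec ℕ n → ℕ → (Fin k → Subset n) → Set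
Feasible k B p S =
  (∀ i j (x : Fin _) → i ≢ j → x ∈ S i → x ∉ S j) ×
  (∀ i → (toℕ i ≡ 0 → MaxIs (S i) p) × (toℕ i ≢ 0 → MaxAbove (S i) p))

Optimal : ∀ k {n} → Vec ℕ n → ℕ → (Fin k → Subset n) → Set
Optimal k B p S = Feasible k B p S × (∀ T → Feasible k B p T → ratio k S B ≤∞ ratio k T B)

-- 1-based access a_p (0 if out of range; not used out of range)
nth : ∀ {n} → Vec ℕ n → ℕ → ℕ
nth [] p = 0
nth (a ∷ A) zero = 0
nth (a ∷ A) (suc zero) = a
nth (a ∷ A) (suc (suc p)) = nth A (suc p)

-- q / m for a rational q and a natural m ≠ 0 (0 if m = 0; not used then)
divℚℕ : ℚ → ℕ → ℚ
divℚℕ q zero = 0ℚ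
divℚℕ q (suc m) = q ℚ.* ((+ 1) ℚ./ suc m)

-- ⌊ a / δ ⌋ for δ > 0 (0 if δ ≤ 0; not used then)
floorDiv : ℕ → ℚ → ℕ
floorDiv a δ with ↥ δ
... | +[1+ t ] = ℤ.∣ floor ((+ (a ℕ.* ↧ₙ δ)) ℚ./ suc t) ∣
... | _ = 0

δ : ∀ {n} → ℚ → Vec ℕ n → ℕ → ℚ
δ {n} ε A p = divℚℕ (ε ℚ.* ((+ nth A p) ℚ./ 1)) (3 ℕ.* n)

rounded : ∀ {n} → ℚ → Vec ℕ n → ℕ → Vec ℕ n
rounded ε A p = map (λ a → floorDiv a (δ ε A p)) A

SortedV : ∀ {n} → Vec ℕ n → Set
SortedV A = ∀ i j → i Fin.≤ j → lookup A i ℕ.≤ lookup A j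

module Submission where

-- Rounding a_i to ⌊a_i / δ⌋ lowers every subset sum, measured in units of δ, by less than n. Every
-- set of a feasible solution contains an index ≥ p, so its sum is at least a_p = 3nδ/ε, and the
-- rounding error n is at most ε/3 of any minimum sum m/δ. Writing M, m for the largest and smallest
-- sums and M′, m′ for their rounded versions, for the rounded optimum S and the true optimum S*
--   R(S) ≤ (M′ + n)/m′ ≤ M*′/m*′ + n/m′ ≤ (3/(3−ε)) R(S*) + (ε/(3−ε)) R(S*) ≤ (1 + ε) R(S*),
-- the middle step being the optimality of S for the rounded instance. All inequalities between
-- fractions are proved in ℕ by cross-multiplication.

open import Defs
open import Data.Nat hiding (_/_)
import Data.Nat as ℕ
open import Data.Nat.Properties
open import Data.Nat.DivMod using (m/n*n≤m; m≡m%n+[m/n]*n; m%n<n)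
open import Data.Nat.Coprimality using (Coprime)
open import Data.Nat.Tactic.RingSolver using (solve-∀)
open import Algebra.Properties.CommutativeSemigroup +-commutativeSemigroup
  using () renaming (interchange to +-interchange)
open import Algebra.Properties.CommutativeSemigroup *-commutativeSemigroup
  using () renaming (interchange to *-interchange; xy∙z≈xz∙y to *-rightComm)
open import Data.Integer as ℤ using (+_; +[1+_]; -[1+_]; +≤+; +<+)
import Data.Integer.Properties as ℤ
open import Data.Integer.DivMod using (div-pos-is-/ℕ)
open import Data.Rational as ℚ using (ℚ; mkℚ; ↥_; ↧ₙ_; toℚᵘ; 0ℚ; 1ℚ; *<*)
  renaming (_<_ to _<ℚ_; _+_ to _+ℚ_)
import Data.Rational.Properties as ℚ
open import Data.Rational.Unnormalised as ℚᵘ using (mkℚᵘ; *≡*; *≤*) renaming (_≃_ to _≃ᵘ_)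
import Data.Rational.Unnormalised.Properties as ℚᵘ
open import Data.Fin using (Fin; zero; suc; toℕ)
open import Data.Fin.Properties using (toℕ<n)
open import Data.Fin.Subset using (Subset; _∈_)
open import Data.Vec using (Vec; []; _∷_; lookup; map; here; there)
open import Data.Bool using (true; false)
open import Data.Product using (∃-syntax; _×_; _,_; proj₁; proj₂)
open import Data.Sum using (inj₁; inj₂)
open import Data.Empty using (⊥-elim-irr)
open import Function using (_∘_)
open import Relation.Nullary using (yes; no)
open import Relation.Binary.PropositionalEquality

f≤maxF : ∀ k (f : Fin k → ℕ) i → f i ≤ maxF k f
f≤maxF (suc k) f zero    = m≤m⊔n _ _
f≤maxF (suc k) f (suc i) = ≤-trans (f≤maxF k (f ∘ suc) i) (m≤n⊔m _ _)

maxF-attained : ∀ k (f : Fin (suc k) → ℕ) → ∃[ i ] maxF (suc k) f ≡ f i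
maxF-attained zero    f = zero , ⊔-identityʳ (f zero)
maxF-attained (suc k) f with ⊔-sel (f zero) (maxF (suc k) (f ∘ suc))
... | inj₁ max≡f0 = zero , max≡f0
... | inj₂ max≡rest with maxF-attained k (f ∘ suc)
...   | i , rest≡fi = suc i , trans max≡rest rest≡fi

minF≤f : ∀ k (f : Fin k → ℕ) i → minF k f ≤ f i
minF≤f (suc zero)    f zero    = ≤-refl
minF≤f (suc (suc k)) f zero    = m⊓n≤m _ _
minF≤f (suc (suc k)) f (suc i) = ≤-trans (m⊓n≤n _ _) (minF≤f (suc k) (f ∘ suc) i)

minF-attained : ∀ k (f : Fin (suc k) → ℕ) → ∃[ i ] minF (suc k) f ≡ f i
minF-attained zero    f = zero , refl
minF-attained (suc k) f with ⊓-sel (f zero) (minF (suc k) (f ∘ suc))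
... | inj₁ min≡f0 = zero , min≡f0
... | inj₂ min≡rest with minF-attained k (f ∘ suc)
...   | i , rest≡fi = suc i , trans min≡rest rest≡fi

-- For δ = u / v: y lies in [x/δ − c, x/δ], cross-multiplied.
record RoundedDown (u v c x y : ℕ) : Set where
  field
    below : u * y ≤ x * v
    above : x * v ≤ u * (y + c)
open RoundedDown

roundedDown-zero : ∀ {u v} → RoundedDown u v 0 0 0
roundedDown-zero {u} = record { below = ≤-reflexive (*-zeroʳ u) ; above = z≤n }

roundedDown-weaken : ∀ {u v c c′ x y} → c ≤ c′ → RoundedDown u v c x y → RoundedDown u v c′ x y
roundedDown-weaken {u} {y = y} c≤c′ r = record
  { below = below r
  ; above = ≤-trans (above r) (*-monoʳ-≤ u (+-monoʳ-≤ y c≤c′)) }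

roundedDown-+ : ∀ {u v c c′ x x′ y y′} → RoundedDown u v c x y → RoundedDown u v c′ x′ y′ →
                RoundedDown u v (c + c′) (x + x′) (y + y′)
roundedDown-+ {u} {v} {c} {c′} {x} {x′} {y} {y′} r r′ = record
  { below = begin
      u * (y + y′)      ≡⟨ *-distribˡ-+ u y y′ ⟩
      u * y + u * y′    ≤⟨ +-mono-≤ (below r) (below r′) ⟩
      x * v + x′ * v    ≡⟨ *-distribʳ-+ v x x′ ⟨
      (x + x′) * v      ∎
  ; above = begin
      (x + x′) * v                  ≡⟨ *-distribʳ-+ v x x′ ⟩
      x * v + x′ * v                ≤⟨ +-mono-≤ (above r) (above r′) ⟩
      u * (y + c) + u * (y′ + c′)   ≡⟨ *-distribˡ-+ u (y + c) (y′ + c′) ⟨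
      u * ((y + c) + (y′ + c′))     ≡⟨ cong (u *_) (+-interchange y c y′ c′) ⟩
      u * ((y + y′) + (c + c′))     ∎ }
  where open ≤-Reasoning

module _ {u v} {f : ℕ → ℕ} (round : ∀ x → RoundedDown u v 1 x (f x)) where

  ΣS-roundedDown : ∀ {n} (S : Subset n) (A : Vec ℕ n) → RoundedDown u v n (ΣS S A) (ΣS S (map f A))
  ΣS-roundedDown []          []      = roundedDown-zero
  ΣS-roundedDown (true ∷ S)  (x ∷ A) = roundedDown-+ (round x) (ΣS-roundedDown S A)
  ΣS-roundedDown (false ∷ S) (x ∷ A) = roundedDown-weaken (n≤1+n _) (ΣS-roundedDown S A)

module _ {u v c} k {X Y : Fin (suc k) → ℕ} (round : ∀ i → RoundedDown u v c (X i) (Y i)) where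

  maxF-roundedDown : RoundedDown u v c (maxF (suc k) X) (maxF (suc k) Y)
  maxF-roundedDown with maxF-attained k X | maxF-attained k Y
  ... | i , maxX≡Xi | j , maxY≡Yj = record
    { below = begin
        u * maxF (suc k) Y  ≡⟨ cong (u *_) maxY≡Yj ⟩
        u * Y j             ≤⟨ below (round j) ⟩
        X j * v             ≤⟨ *-monoˡ-≤ v (f≤maxF (suc k) X j) ⟩
        maxF (suc k) X * v  ∎
    ; above = begin
        maxF (suc k) X * v        ≡⟨ cong (_* v) maxX≡Xi ⟩
        X i * v                   ≤⟨ above (round i) ⟩
        u * (Y i + c)             ≤⟨ *-monoʳ-≤ u (+-monoˡ-≤ c (f≤maxF (suc k) Y i)) ⟩
        u * (maxF (suc k) Y + c)  ∎ }
    where open ≤-Reasoning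

  minF-roundedDown : RoundedDown u v c (minF (suc k) X) (minF (suc k) Y)
  minF-roundedDown with minF-attained k X | minF-attained k Y
  ... | i , minX≡Xi | j , minY≡Yj = record
    { below = begin
        u * minF (suc k) Y  ≤⟨ *-monoʳ-≤ u (minF≤f (suc k) Y i) ⟩
        u * Y i             ≤⟨ below (round i) ⟩
        X i * v             ≡⟨ cong (_* v) minX≡Xi ⟨
        minF (suc k) X * v  ∎
    ; above = begin
        minF (suc k) X * v        ≤⟨ *-monoˡ-≤ v (minF≤f (suc k) X j) ⟩
        X j * v                   ≤⟨ above (round j) ⟩
        u * (Y j + c)             ≡⟨ cong (λ y → u * (y + c)) minY≡Yj ⟨
        u * (minF (suc k) Y + c)  ∎ }
    where open ≤-Reasoning

infix 4 _/_≤_/_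

record _/_≤_/_ (a b c d : ℕ) : Set where
  constructor cross
  field cross≤ : a * d ≤ c * b

/≤/-trans : ∀ {a b c d e f} .{{_ : NonZero d}} → a / b ≤ c / d → c / d ≤ e / f → a / b ≤ e / f
/≤/-trans {a} {b} {c} {d} {e} {f} (cross ad≤cb) (cross cf≤ed) =
  cross (*-cancelʳ-≤ (a * f) (e * b) d (begin
  a * f * d  ≡⟨ *-rightComm a f d ⟩
  a * d * f  ≤⟨ *-monoˡ-≤ f ad≤cb ⟩
  c * b * f  ≡⟨ *-rightComm c b f ⟩
  c * f * b  ≤⟨ *-monoˡ-≤ b cf≤ed ⟩
  e * d * b  ≡⟨ *-rightComm e d b ⟩
  e * b * d  ∎))
  where open ≤-Reasoning

/≤/-+ : ∀ {a a′ b c c′ d} → a / b ≤ c / d → a′ / b ≤ c′ / d → (a + a′) / b ≤ (c + c′) / d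
/≤/-+ {a} {a′} {b} {c} {c′} {d} (cross ad≤cb) (cross a′d≤c′b) = cross (begin
  (a + a′) * d    ≡⟨ *-distribʳ-+ d a a′ ⟩
  a * d + a′ * d  ≤⟨ +-mono-≤ ad≤cb a′d≤c′b ⟩
  c * b + c′ * b  ≡⟨ *-distribʳ-+ b c c′ ⟨
  (c + c′) * b    ∎)
  where open ≤-Reasoning

/≤/-scale : ∀ {a b c d} x y → a / b ≤ c / d → (a * x) / (b * y) ≤ (c * x) / (d * y)
/≤/-scale {a} {b} {c} {d} x y (cross ad≤cb) = cross (begin
  (a * x) * (d * y)  ≡⟨ *-interchange a x d y ⟩
  (a * d) * (x * y)  ≤⟨ *-monoˡ-≤ (x * y) ad≤cb ⟩
  (c * b) * (x * y)  ≡⟨ *-interchange c x b y ⟨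
  (c * x) * (b * y)  ∎)
  where open ≤-Reasoning

roundedDown-ratio : ∀ {u v c c′ M m M′ m′} .{{_ : NonZero u}} .{{_ : NonZero v}} →
  RoundedDown u v c M M′ → RoundedDown u v c′ m m′ → M / m ≤ (M′ + c) / m′
roundedDown-ratio {u} {v} {c} {M = M} {m} {M′} {m′} rM rm =
  cross (*-cancelʳ-≤ (M * m′) ((M′ + c) * m) (u * v) {{m*n≢0 u v}} (begin
    M * m′ * (u * v)        ≡⟨ lhs M m′ u v ⟩
    (M * v) * (u * m′)      ≤⟨ *-mono-≤ (above rM) (below rm) ⟩
    u * (M′ + c) * (m * v)  ≡⟨ rhs u (M′ + c) m v ⟩
    (M′ + c) * m * (u * v)  ∎))
  where
  open ≤-Reasoning
  lhs : ∀ x y z w → x * y * (z * w) ≡ (x * w) * (z * y)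
  lhs = solve-∀
  rhs : ∀ x y z w → x * y * (z * w) ≡ y * z * (x * w)
  rhs = solve-∀

Max Min : ∀ k {n} → (Fin k → Subset n) → Vec ℕ n → ℕ
Max k S B = maxF k (λ i → ΣS (S i) B)
Min k S B = minF k (λ i → ΣS (S i) B)

-- Here δ = u / v, ε = e / D and a = a_p.
module Rounding {u v n e D a : ℕ} .{{_ : NonZero u}} .{{_ : NonZero v}}
                .{{_ : NonZero n}} .{{_ : NonZero D}} .{{_ : NonZero a}}
                (δ≡εa/3n : u * (n * (3 * D)) ≡ e * a * v) (e≤D : e ≤ D) where

  W : ℕ
  W = 3 * D ∸ e

  e+W≡3D : e + W ≡ 3 * D
  e+W≡3D = m+[n∸m]≡n (≤-trans e≤D (m≤n*m D 3))

  2D≤W : 2 * D ≤ W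
  2D≤W = +-cancelˡ-≤ e (2 * D) W (begin
    e + 2 * D  ≤⟨ +-monoˡ-≤ (2 * D) e≤D ⟩
    D + 2 * D  ≡⟨⟩
    3 * D      ≡⟨ e+W≡3D ⟨
    e + W      ∎)
    where open ≤-Reasoning

  instance
    W≢0 : NonZero W
    W≢0 = >-nonZero (≤-trans (>-nonZero⁻¹ (2 * D) {{m*n≢0 2 D}}) 2D≤W)

  [3+ε]/[3-ε]≤1+ε : ((e + W) + e) / W ≤ (D + e) / D
  [3+ε]/[3-ε]≤1+ε = cross (begin
    ((e + W) + e) * D    ≡⟨ lhs e W D ⟩
    e * (2 * D) + W * D  ≤⟨ +-monoˡ-≤ (W * D) (*-monoʳ-≤ e 2D≤W) ⟩
    e * W + W * D        ≡⟨ rhs e W D ⟩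
    (D + e) * W          ∎)
    where
    open ≤-Reasoning
    lhs : ∀ e W D → ((e + W) + e) * D ≡ e * (2 * D) + W * D
    lhs = solve-∀
    rhs : ∀ e W D → e * W + W * D ≡ (D + e) * W
    rhs = solve-∀

  -- M, m are the largest and smallest sums of a solution, M′, m′ those after rounding.
  record Profile (M m M′ m′ : ℕ) : Set where
    field
      max-rounded : RoundedDown u v n M M′
      min-rounded : RoundedDown u v n m m′
      a≤min       : a ≤ m
      min≤max     : m ≤ M

  module _ {M m M′ m′} (P : Profile M m M′ m′) where
    open Profile P

    -- n = (ε/3) a/δ ≤ (ε/3) m/δ ≤ (ε/3)(m′ + n)
    rounding-error-bound : n * W ≤ e * m′
    rounding-error-bound = +-cancelʳ-≤ (e * n) (n * W) (e * m′) (*-cancelˡ-≤ u (begin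
      u * (n * W + e * n)  ≡⟨ lhs u n W e ⟩
      u * (n * (e + W))    ≡⟨ cong (λ x → u * (n * x)) e+W≡3D ⟩
      u * (n * (3 * D))    ≡⟨ δ≡εa/3n ⟩
      e * a * v            ≤⟨ *-monoˡ-≤ v (*-monoʳ-≤ e a≤min) ⟩
      e * m * v            ≡⟨ *-assoc e m v ⟩
      e * (m * v)          ≤⟨ *-monoʳ-≤ e (above min-rounded) ⟩
      e * (u * (m′ + n))   ≡⟨ rhs e u m′ n ⟩
      u * (e * m′ + e * n) ∎))
      where
      open ≤-Reasoning
      lhs : ∀ u n W e → u * (n * W + e * n) ≡ u * (n * (e + W))
      lhs = solve-∀
      rhs : ∀ e u m′ n → e * (u * (m′ + n)) ≡ u * (e * m′ + e * n)
      rhs = solve-∀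

    unrounded-min-bound : W * (m * v) ≤ (e + W) * (u * m′)
    unrounded-min-bound = begin
      W * (m * v)              ≤⟨ *-monoʳ-≤ W (above min-rounded) ⟩
      W * (u * (m′ + n))       ≡⟨ lhs W u m′ n ⟩
      u * (W * m′ + n * W)     ≤⟨ *-monoʳ-≤ u (+-monoʳ-≤ (W * m′) rounding-error-bound) ⟩
      u * (W * m′ + e * m′)    ≡⟨ rhs u W m′ e ⟩
      (e + W) * (u * m′)       ∎
      where
      open ≤-Reasoning
      lhs : ∀ W u m′ n → W * (u * (m′ + n)) ≡ u * (W * m′ + n * W)
      lhs = solve-∀
      rhs : ∀ u W m′ e → u * (W * m′ + e * m′) ≡ (e + W) * (u * m′)
      rhs = solve-∀

    rounded-ratio-bound : M′ / m′ ≤ ((e + W) * M) / (W * m)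
    rounded-ratio-bound = cross (*-cancelʳ-≤ _ _ (u * v) {{m*n≢0 u v}} (begin
      M′ * (W * m) * (u * v)         ≡⟨ lhs M′ W m u v ⟩
      (u * M′) * (W * (m * v))       ≤⟨ *-mono-≤ (below max-rounded) unrounded-min-bound ⟩
      (M * v) * ((e + W) * (u * m′)) ≡⟨ rhs M v e W u m′ ⟩
      ((e + W) * M) * m′ * (u * v)   ∎))
      where
      open ≤-Reasoning
      lhs : ∀ M′ W m u v → M′ * (W * m) * (u * v) ≡ (u * M′) * (W * (m * v))
      lhs = solve-∀
      rhs : ∀ M v e W u m′ → (M * v) * ((e + W) * (u * m′)) ≡ ((e + W) * M) * m′ * (u * v)
      rhs = solve-∀

    rounded-min-nonZero : NonZero m′
    rounded-min-nonZero = ≢-nonZero λ m′≡0 → ≢-nonZero⁻¹ (n * W) {{m*n≢0 n W}}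
      (n≤0⇒n≡0 (≤-trans rounding-error-bound (≤-reflexive (trans (cong (e *_) m′≡0) (*-zeroʳ e)))))

    min-nonZero : NonZero m
    min-nonZero = >-nonZero (≤-trans (>-nonZero⁻¹ a) a≤min)

  solution-profile : ∀ {k f} → (∀ x → RoundedDown u v 1 x (f x)) →
                     (A : Vec ℕ n) (T : Fin (suc k) → Subset n) → (∀ i → a ≤ ΣS (T i) A) →
                     Profile (Max (suc k) T A) (Min (suc k) T A)
                             (Max (suc k) T (map f A)) (Min (suc k) T (map f A))
  solution-profile {k} round A T a≤ΣS = record
    { max-rounded = maxF-roundedDown k (λ i → ΣS-roundedDown round (T i) A)
    ; min-rounded = minF-roundedDown k (λ i → ΣS-roundedDown round (T i) A)
    ; a≤min       = let i , min≡Σi = minF-attained k sums in subst (a ≤_) (sym min≡Σi) (a≤ΣS i)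
    ; min≤max     = ≤-trans (minF≤f (suc k) sums zero) (f≤maxF (suc k) sums zero) }
    where
    sums : Fin (suc k) → ℕ
    sums i = ΣS (T i) A

  ratio≤[1+ε]ratio* : ∀ {M m M′ m′ M* m* M*′ m*′} → Profile M m M′ m′ → Profile M* m* M*′ m*′ →
                      M′ / m′ ≤ M*′ / m*′ → M / m ≤ ((D + e) * M*) / (D * m*)
  ratio≤[1+ε]ratio* {M} {m} {M′} {m′} {M*} {m*} {M*′} {m*′} P P* optimal =
    /≤/-trans {{m*n≢0 W m*}} ratio≤[3+ε]/[3-ε] [3+ε]/[3-ε]≤1+ε-scaled
    where
    instance
      _ = rounded-min-nonZero P
      _ = rounded-min-nonZero P*
      _ = min-nonZero P*
    rounded-ratio : M′ / m′ ≤ ((e + W) * M*) / (W * m*)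
    rounded-ratio = /≤/-trans optimal (rounded-ratio-bound P*)
    rounding-error : n / m′ ≤ (e * M*) / (W * m*)
    rounding-error = cross (begin
      n * (W * m*)  ≡⟨ *-assoc n W m* ⟨
      n * W * m*    ≤⟨ *-mono-≤ (rounding-error-bound P) (Profile.min≤max P*) ⟩
      e * m′ * M*   ≡⟨ *-rightComm e m′ M* ⟩
      e * M* * m′   ∎)
      where open ≤-Reasoning
    ratio≤[3+ε]/[3-ε] : M / m ≤ ((e + W) * M* + e * M*) / (W * m*)
    ratio≤[3+ε]/[3-ε] = /≤/-trans (roundedDown-ratio (Profile.max-rounded P) (Profile.min-rounded P))
                                  (/≤/-+ rounded-ratio rounding-error)
    [3+ε]/[3-ε]≤1+ε-scaled : ((e + W) * M* + e * M*) / (W * m*) ≤ ((D + e) * M*) / (D * m*)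
    [3+ε]/[3-ε]≤1+ε-scaled = subst (λ x → x / (W * m*) ≤ ((D + e) * M*) / (D * m*))
                                   (*-distribʳ-+ M* (e + W) e) (/≤/-scale M* m* [3+ε]/[3-ε]≤1+ε)

lookup≤ΣS : ∀ {n} (S : Subset n) (B : Vec ℕ n) {j} → j ∈ S → lookup B j ≤ ΣS S B
lookup≤ΣS (true ∷ S)  (b ∷ B) here        = m≤m+n b (ΣS S B)
lookup≤ΣS (true ∷ S)  (b ∷ B) (there j∈S) = ≤-trans (lookup≤ΣS S B j∈S) (m≤n+m (ΣS S B) b)
lookup≤ΣS (false ∷ S) (b ∷ B) (there j∈S) = lookup≤ΣS S B j∈S

nth≡lookup : ∀ {n} (A : Vec ℕ n) p → 1 ≤ p → p ≤ n → ∃[ i ] suc (toℕ i) ≡ p × nth A p ≡ lookup A i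
nth≡lookup (x ∷ A) 1             _ _         = zero , refl , refl
nth≡lookup (x ∷ A) (suc (suc p)) _ (s≤s p<n) with nth≡lookup A (suc p) (s≤s z≤n) p<n
... | i , i+1≡p , nth≡Ai = suc i , cong suc i+1≡p , nth≡Ai

nth≤lookup : ∀ {n} (A : Vec ℕ n) → SortedV A →
             ∀ {p} j → 1 ≤ p → p ≤ suc (toℕ j) → nth A p ≤ lookup A j
nth≤lookup A sorted {p} j 1≤p p≤j+1 with nth≡lookup A p 1≤p (≤-trans p≤j+1 (toℕ<n j))
... | i , refl , nth≡Ai = subst (_≤ lookup A j) (sym nth≡Ai) (sorted i j (s≤s⁻¹ p≤j+1))

feasible⇒index≥p : ∀ {k n} {B : Vec ℕ n} {p S} → Feasible k B p S →
                   ∀ i → ∃[ j ] j ∈ S i × p ≤ suc (toℕ j)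
feasible⇒index≥p (_ , maxima) i with toℕ i ≟ 0
... | yes i≡0 = let j , j∈S , j+1≡p = proj₁ (proj₁ (maxima i) i≡0)
                in j , j∈S , ≤-reflexive (sym j+1≡p)
... | no  i≢0 = let j , j∈S , p<j+1 = proj₂ (maxima i) i≢0 in j , j∈S , <⇒≤ p<j+1

nth≤ΣS : ∀ {k n} (A : Vec ℕ n) → SortedV A →
         ∀ {p S} → 1 ≤ p → Feasible k A p S → ∀ i → nth A p ≤ ΣS (S i) A
nth≤ΣS A sorted 1≤p feasible i with feasible⇒index≥p {B = A} feasible i
... | j , j∈S , p≤j+1 = ≤-trans (nth≤lookup A sorted j 1≤p p≤j+1) (lookup≤ΣS _ _ j∈S)

/-cross-bounds : ∀ N D x s .{{_ : NonZero D}} .{{_ : NonZero s}} → N * s ≡ x * D →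
                 s * (N ℕ./ D) ≤ x × x ≤ s * (N ℕ./ D + 1)
/-cross-bounds N D x s Ns≡xD = lower , upper
  where
  open ≤-Reasoning
  y : ℕ
  y = N ℕ./ D
  lower : s * y ≤ x
  lower = *-cancelʳ-≤ (s * y) x D (begin
    s * y * D    ≡⟨ *-assoc s y D ⟩
    s * (y * D)  ≡⟨ *-comm s (y * D) ⟩
    y * D * s    ≤⟨ *-monoˡ-≤ s (m/n*n≤m N D) ⟩
    N * s        ≡⟨ Ns≡xD ⟩
    x * D        ∎)
  upper : x ≤ s * (y + 1)
  upper = <⇒≤ (*-cancelʳ-< D x (s * (y + 1)) (begin-strict
    x * D                  ≡⟨ Ns≡xD ⟨
    N * s                  ≡⟨ cong (_* s) (m≡m%n+[m/n]*n N D) ⟩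
    (N ℕ.% D + y * D) * s  <⟨ *-monoˡ-< s (+-monoˡ-< (y * D) (m%n<n N D)) ⟩
    (D + y * D) * s        ≡⟨ reorder y D s ⟩
    s * (y + 1) * D        ∎))
    where
    reorder : ∀ y D s → (D + y * D) * s ≡ s * (y + 1) * D
    reorder = solve-∀

toℚᵘ-/ : ∀ x s .{{_ : NonZero s}} → toℚᵘ (+ x ℚ./ s) ≃ᵘ + x ℚᵘ./ s
toℚᵘ-/ x (suc s) = ℚ.toℚᵘ-fromℚᵘ (mkℚᵘ (+ x) s)

nonNegative-numerator : ∀ (r : ℚ) → ℚ.NonNegative r → ∃[ N ] ↥ r ≡ + N
nonNegative-numerator (mkℚ (+ N)    _ _) _                      = N , refl
nonNegative-numerator (mkℚ -[1+ _ ] _ _) record { nonNeg = () }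

≃ᵘ-cross : ∀ (r : ℚ) {N x s} .{{_ : NonZero s}} → ↥ r ≡ + N → toℚᵘ r ≃ᵘ + x ℚᵘ./ s → N * s ≡ x * ↧ₙ r
≃ᵘ-cross (mkℚ _ d _) {N} {x} {suc s} refl (*≡* eq) =
  ℤ.+-injective (trans (ℤ.pos-* N (suc s)) (trans eq (sym (ℤ.pos-* x (suc d)))))

positive-≃ᵘ-cross : ∀ (r : ℚ) {x s} .{{_ : NonZero x}} .{{_ : NonZero s}} →
                    toℚᵘ r ≃ᵘ + x ℚᵘ./ s → ∃[ t ] ↥ r ≡ +[1+ t ] × suc t * s ≡ x * ↧ₙ r
positive-≃ᵘ-cross (mkℚ +[1+ t ] _ _) {suc _} {suc _} (*≡* eq) = t , refl , ℤ.+-injective eq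
positive-≃ᵘ-cross (mkℚ (+ 0)    _ _) {suc _} {suc _} (*≡* ())
positive-≃ᵘ-cross (mkℚ -[1+ _ ] _ _) {suc _} {suc _} (*≡* ())

∣floor∣-nonNegative : ∀ (r : ℚ) {N} → ↥ r ≡ + N → ℤ.∣ ℚ.floor r ∣ ≡ N ℕ./ ↧ₙ r
∣floor∣-nonNegative (mkℚ _ d _) {N} refl = cong ℤ.∣_∣ (div-pos-is-/ℕ (+ N) (suc d))

∣floor∣-bounds : ∀ x s .{{_ : NonZero s}} →
  s * ℤ.∣ ℚ.floor (+ x ℚ./ s) ∣ ≤ x × x ≤ s * (ℤ.∣ ℚ.floor (+ x ℚ./ s) ∣ + 1)
∣floor∣-bounds x s with nonNegative-numerator (+ x ℚ./ s) (ℚ.normalize-nonNeg x s)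
... | N , ↥≡N rewrite ∣floor∣-nonNegative (+ x ℚ./ s) ↥≡N =
  /-cross-bounds N _ x s (≃ᵘ-cross (+ x ℚ./ s) ↥≡N (toℚᵘ-/ x s))

floorDiv-roundedDown : ∀ q {t} → ↥ q ≡ +[1+ t ] → ∀ a → RoundedDown (suc t) (↧ₙ q) 1 a (floorDiv a q)
floorDiv-roundedDown (mkℚ _ d _) {t} refl a with ∣floor∣-bounds (a * suc d) (suc t)
... | lower , upper = record { below = lower ; above = upper }

δ-cross : ∀ {n} e d .{c : Coprime (suc e) (suc d)} (A : Vec ℕ n) p
          .{{_ : NonZero n}} .{{_ : NonZero (nth A p)}} →
  ∃[ t ] ↥ δ (mkℚ +[1+ e ] d c) A p ≡ +[1+ t ]
       × suc t * (n * (3 * suc d)) ≡ suc e * nth A p * ↧ₙ δ (mkℚ +[1+ e ] d c) A p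
δ-cross {suc n} e d {c} A p = positive-≃ᵘ-cross (δ ε A p) {{m*n≢0 (suc e) a}} δ≃
  where
  ε : ℚ
  ε = mkℚ +[1+ e ] d c
  a : ℕ
  a = nth A p
  δ≃ : toℚᵘ (δ ε A p) ≃ᵘ + (suc e * a) ℚᵘ./ (suc n * (3 * suc d))
  δ≃ = ℚᵘ.≃-trans
    (ℚᵘ.≃-trans (ℚ.toℚᵘ-homo-* (ε ℚ.* (+ a ℚ./ 1)) (+ 1 ℚ./ (3 * suc n)))
                (ℚᵘ.*-cong (ℚᵘ.≃-trans (ℚ.toℚᵘ-homo-* ε (+ a ℚ./ 1))
                                       (ℚᵘ.*-congˡ {toℚᵘ ε} (toℚᵘ-/ a 1)))
                           (toℚᵘ-/ 1 (3 * suc n))))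
    (*≡* (begin
      ((+ suc e ℤ.* + a) ℤ.* + 1) ℤ.* + s  ≡⟨ cong (ℤ._* + s) (ℤ.*-identityʳ (+ suc e ℤ.* + a)) ⟩
      (+ suc e ℤ.* + a) ℤ.* + s            ≡⟨ cong (ℤ._* + s) (ℤ.pos-* (suc e) a) ⟨
      + (suc e * a) ℤ.* + s                ≡⟨ cong (λ x → + (suc e * a) ℤ.* + x) (reorder n d) ⟩
      + (suc e * a) ℤ.* + ((suc d * 1) * (3 * suc n))  ∎))
    where
    open ≡-Reasoning
    s : ℕ
    s = suc n * (3 * suc d)
    reorder : ∀ n d → suc n * (3 * suc d) ≡ (suc d * 1) * (3 * suc n)
    reorder = solve-∀

ratio-fin : ∀ k {n} (S : Fin k → Subset n) B .{{_ : NonZero (Min k S B)}} →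
            ratio k S B ≡ fin (+ Max k S B ℚ./ Min k S B)
ratio-fin k S B {{m≢0}} with Min k S B
... | suc _ = refl
... | zero  = ⊥-elim-irr (NonZero.nonZero m≢0)

/-≤⇒/≤/ : ∀ {a b c d} .{{_ : NonZero b}} .{{_ : NonZero d}} → + a ℚ./ b ℚ.≤ + c ℚ./ d → a / b ≤ c / d
/-≤⇒/≤/ {a} {b@(suc _)} {c} {d@(suc _)} le
  with ℚᵘ.≤-respʳ-≃ (toℚᵘ-/ c d) (ℚᵘ.≤-respˡ-≃ (toℚᵘ-/ a b) (ℚ.toℚᵘ-mono-≤ le))
... | *≤* ad≤cb = cross (ℤ.drop‿+≤+ (subst₂ ℤ._≤_ (sym (ℤ.pos-* a d)) (sym (ℤ.pos-* c b)) ad≤cb))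

/≤/⇒≤-1+ : ∀ {a b c d e f} .{{_ : NonZero b}} .{{_ : NonZero d}} .{cop : Coprime e (suc f)} →
           a / b ≤ ((suc f + e) * c) / (suc f * d) →
           + a ℚ./ b ℚ.≤ (1ℚ ℚ.+ mkℚ (+ e) f cop) ℚ.* (+ c ℚ./ d)
/≤/⇒≤-1+ {a} {b@(suc _)} {c} {suc d} {e} {f} {cop} (cross ad≤cb) =
  ℚ.toℚᵘ-cancel-≤ (ℚᵘ.≤-respˡ-≃ (ℚᵘ.≃-sym (toℚᵘ-/ a b)) (ℚᵘ.≤-respʳ-≃ (ℚᵘ.≃-sym rhs≃)
    (*≤* (subst₂ ℤ._≤_ (ℤ.pos-* a (D * suc d)) (ℤ.pos-* ((D + e) * c) b) (+≤+ ad≤cb)))))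
  where
  ε : ℚ
  ε = mkℚ (+ e) f cop
  D : ℕ
  D = suc f
  rhs≃ : toℚᵘ ((1ℚ ℚ.+ ε) ℚ.* (+ c ℚ./ suc d)) ≃ᵘ + ((D + e) * c) ℚᵘ./ (D * suc d)
  rhs≃ = ℚᵘ.≃-trans (ℚ.toℚᵘ-homo-* (1ℚ ℚ.+ ε) (+ c ℚ./ suc d))
           (ℚᵘ.≃-trans (ℚᵘ.*-cong (ℚ.toℚᵘ-homo-+ 1ℚ ε) (toℚᵘ-/ c (suc d)))
             (*≡* (begin
      (+ 1 ℤ.* + D ℤ.+ + e ℤ.* + 1) ℤ.* + c ℤ.* + (D * suc d)
        ≡⟨ cong₂ (λ x y → (x ℤ.+ y) ℤ.* + c ℤ.* + (D * suc d)) (ℤ.pos-* 1 D) (ℤ.pos-* e 1) ⟨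
      (+ (1 * D) ℤ.+ + (e * 1)) ℤ.* + c ℤ.* + (D * suc d)
        ≡⟨ cong (λ x → x ℤ.* + c ℤ.* + (D * suc d)) (ℤ.pos-+ (1 * D) (e * 1)) ⟨
      + (1 * D + e * 1) ℤ.* + c ℤ.* + (D * suc d)
        ≡⟨ cong (ℤ._* + (D * suc d)) (ℤ.pos-* (1 * D + e * 1) c) ⟨
      + ((1 * D + e * 1) * c) ℤ.* + (D * suc d)
        ≡⟨ ℤ.pos-* ((1 * D + e * 1) * c) (D * suc d) ⟨
      + ((1 * D + e * 1) * c * (D * suc d))
        ≡⟨ cong +_ (reorder D e c (suc d)) ⟩
      + ((D + e) * c * ((1 * D) * suc d))
        ≡⟨ ℤ.pos-* ((D + e) * c) ((1 * D) * suc d) ⟩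
      + ((D + e) * c) ℤ.* + ((1 * D) * suc d) ∎)))
    where
    open ≡-Reasoning
    reorder : ∀ D e c d → (1 * D + e * 1) * c * (D * d) ≡ (D + e) * c * ((1 * D) * d)
    reorder = solve-∀

ratio-≤∞⇒/≤/ : ∀ k {n} (S T : Fin k → Subset n) B
               .{{_ : NonZero (Min k S B)}} .{{_ : NonZero (Min k T B)}} →
               ratio k S B ≤∞ ratio k T B → Max k S B / Min k S B ≤ Max k T B / Min k T B
ratio-≤∞⇒/≤/ k S T B le = /-≤⇒/≤/ (subst₂ _≤∞_ (ratio-fin k S B) (ratio-fin k T B) le)

/≤/⇒ratio-≤∞ : ∀ k {n} (S T : Fin k → Subset n) A {e d} .{c : Coprime e (suc d)}
               .{{_ : NonZero (Min k S A)}} .{{_ : NonZero (Min k T A)}} →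
               Max k S A / Min k S A ≤ ((suc d + e) * Max k T A) / (suc d * Min k T A) →
               ratio k S A ≤∞ scale (1ℚ +ℚ mkℚ (+ e) d c) (ratio k T A)
/≤/⇒ratio-≤∞ k S T A {e} {d} {c} le =
  subst₂ _≤∞_ (sym (ratio-fin k S A)) (cong (scale (1ℚ +ℚ mkℚ (+ e) d c)) (sym (ratio-fin k T A)))
    (/≤/⇒≤-1+ {c = Max k T A} {e = e} {f = d} {cop = c} le)

<1⇒numerator≤ : ∀ {e d} .{c : Coprime e (suc d)} → mkℚ (+ e) d c <ℚ 1ℚ → e ≤ suc d
<1⇒numerator≤ {e} {d} (*<* e*1<1*d) = <⇒≤ (subst₂ _<_ (*-identityʳ e) (*-identityˡ (suc d))
  (ℤ.drop‿+<+ (subst₂ ℤ._<_ (sym (ℤ.pos-* e 1)) (sym (ℤ.pos-* 1 (suc d))) e*1<1*d)))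

module _ {u v n e d a} .{{_ : NonZero u}} .{{_ : NonZero v}} .{{_ : NonZero n}} .{{_ : NonZero a}}
         (δ≡εa/3n : u * (n * (3 * suc d)) ≡ e * a * v) (e≤D : e ≤ suc d) where
  open Rounding {u} {v} {n} {e} {suc d} {a} δ≡εa/3n e≤D

  rounded-optimum-ratio≤ : ∀ {k f} → (∀ x → RoundedDown u v 1 x (f x)) →
    (A : Vec ℕ n) (S S* : Fin (suc k) → Subset n) .{c : Coprime e (suc d)} →
    (∀ i → a ≤ ΣS (S i) A) → (∀ i → a ≤ ΣS (S* i) A) →
    ratio (suc k) S (map f A) ≤∞ ratio (suc k) S* (map f A) →
    ratio (suc k) S A ≤∞ scale (1ℚ +ℚ mkℚ (+ e) d c) (ratio (suc k) S* A)
  rounded-optimum-ratio≤ {k} {f} round A S S* {c} a≤ΣS a≤ΣS* optimal =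
    /≤/⇒ratio-≤∞ (suc k) S S* A {c = c}
      (ratio≤[1+ε]ratio* P P* (ratio-≤∞⇒/≤/ (suc k) S S* (map f A) optimal))
    where
    P : Profile (Max (suc k) S A) (Min (suc k) S A)
                (Max (suc k) S (map f A)) (Min (suc k) S (map f A))
    P = solution-profile round A S a≤ΣS
    P* : Profile (Max (suc k) S* A) (Min (suc k) S* A)
                 (Max (suc k) S* (map f A)) (Min (suc k) S* (map f A))
    P* = solution-profile round A S* a≤ΣS*
    instance
      _ : NonZero (Min (suc k) S (map f A))
      _ = rounded-min-nonZero P
      _ : NonZero (Min (suc k) S* (map f A))
      _ = rounded-min-nonZero P*
      _ : NonZero (Min (suc k) S A)
      _ = min-nonZero P
      _ : NonZero (Min (suc k) S* A)
      _ = min-nonZero P*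

theorem14 : (k n : ℕ) → 2 ≤ k → (A : Vec ℕ n) → SortedV A → (∀ i → 0 < lookup A i)
    → (p : ℕ) → 1 ≤ p → p + k ≤ n + 1
    → (ε : ℚ) → 0ℚ <ℚ ε → ε <ℚ 1ℚ
    → (S S* : Fin k → Subset n)
    → Optimal k (rounded ε A p) p S
    → Optimal k A p S*
    → ratio k S A ≤∞ scale (1ℚ +ℚ ε) (ratio k S* A)
theorem14 k n (s≤s _) A sorted positive p 1≤p p+k≤n+1 ε@(mkℚ +[1+ e ] d coprime) _ ε<1 S S*
          (feasible , optimal) (feasible* , _) =
  rounded-optimum-ratio≤ (proj₂ (proj₂ δ-positive)) (<1⇒numerator≤ ε<1)
    (floorDiv-roundedDown (δ ε A p) (proj₁ (proj₂ δ-positive))) A S S* {coprime}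
    -- Feasible k B p T does not mention B: S and S* are feasible for both A and A_r.
    (nth≤ΣS A sorted 1≤p feasible) (nth≤ΣS A sorted 1≤p feasible*) (optimal S* feasible*)
  where
  p≤n : p ≤ n
  p≤n = +-cancelʳ-≤ 1 p n (≤-trans (+-monoʳ-≤ p (s≤s z≤n)) p+k≤n+1)
  instance
    n≢0 : NonZero n
    n≢0 = >-nonZero (≤-trans 1≤p p≤n)
    a≢0 : NonZero (nth A p)
    a≢0 = let i , _ , a≡Ai = nth≡lookup A p 1≤p p≤n
          in >-nonZero (subst (0 <_) (sym a≡Ai) (positive i))
  δ-positive : ∃[ t ] ↥ δ ε A p ≡ +[1+ t ]
                     × suc t * (n * (3 * suc d)) ≡ suc e * nth A p * ↧ₙ δ ε A p
  δ-positive = δ-cross e d A p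
theorem14 _ _ _ _ _ _ _ _ _ (mkℚ (+ 0) _ _) (*<* (+<+ ())) _ _ _ _ _
theorem14 _ _ _ _ _ _ _ _ _ (mkℚ -[1+ _ ] _ _) (*<* ()) _ _ _ _ _
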